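{- Let $G=(U,V,E)$ be a bipartite graph, $k\ge0$ an integer, and $(S,C)$ an instance with $S=(U_S,V_S)$, $C=(U_C,V_C)$. Let $u_1,\dots,u_{|U_C|}$ and $v_1,\dots,v_{|V_C|}$ be the vertices of $U_C$ and $V_C$ in ascending order of $\overline d_S(\cdot)$, and set $\overline d_S^i(U_C)=\sum_{t=1}^{i}\overline d_S(u_t)$, $\overline d_S^j(V_C)=\sum_{t=1}^{j}\overline d_S(v_t)$. Let $i$ be the largest value in $\{0,\dots,|U_C|\}$ with $\overline d_S^i(U_C)\le k-|\overline E_S|$ and $j$ the largest value in $\{0,\dots,|V_C|\}$ with $\overline d_S^j(V_C)\le k-|\overline E_S|$. Then every $k$-MDB $D=(U_D,V_D,E_D)$ derived from $(S,C)$ satisfies $|U_D|\le|U_S|+i$ and $|V_D|\le|V_S|+j$.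
   Context: For $S=(U_S,V_S)$ with $U_S\subseteq U$, $V_S\subseteq V$, $G(S)$ is the subgraph induced by $U_S\cup V_S$ and $\overline E_S=(U_S\times V_S)\setminus E$. For a vertex $x$ and a vertex set $X$, $\overline d_X(x)$ is the number of vertices of $X$ on the side opposite to $x$ that are not adjacent to $x$. A $k$-defective biclique is a subgraph $(U_D,V_D,E_D)$ with $|(U_D\times V_D)\setminus E_D|\le k$. An instance is a pair $(S,C)$ of disjoint vertex sets such that $G(S)$ is a $k$-defective biclique and $G(S\cup\{x\})$ is a $k$-defective biclique for every $x\in C$. A $k$-MDB derived from $(S,C)$ is a $k$-defective biclique $G(S\cup C')$ with $C'\subseteq C$ having the maximum number of edges among all $k$-defective bicliques of this form. -}

module Defs where

open import Data.Nat using (ℕ; zero; suc; _+_; _≤_; _∸_)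
open import Data.Bool using (Bool; true; false; _∧_; not; if_then_else_)
open import Data.Fin using (Fin)
import Data.Fin as Fin
open import Data.Fin.Subset using (Subset; _∪_; _∩_; _⊆_; ∣_∣; ⁅_⁆; Empty; ⊥)
import Data.Fin.Subset as Sub
open import Data.Vec using (lookup)
open import Data.List using (List; map; take)
open import Data.Nat.ListAction using (sum)
import Data.List.Membership.Propositional as L
open import Data.List.Relation.Unary.Unique.Propositional using (Unique)
open import Data.List.Relation.Unary.Linked using (Linked)
open import Data.Product using (_×_)
open import Function.Bundles using (_⇔_)
open import Relation.Binary.PropositionalEquality using (_≡_)

∑ : (n : ℕ) → (Fin n → ℕ) → ℕ
∑ zero    f = 0
∑ (suc n) f = f Fin.zero + ∑ n (λ i → f (Fin.suc i))

[_] : Bool → ℕ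
[ b ] = if b then 1 else 0

-- A bipartite graph G = (U, V, E) with U = Fin m, V = Fin n,
-- and edge relation E u v (true = edge).
BGraph : ℕ → ℕ → Set
BGraph m n = Fin m → Fin n → Bool

module _ {m n : ℕ} (E : BGraph m n) where

  nonEdges : Subset m → Subset n → ℕ
  nonEdges US VS = ∑ m (λ u → ∑ n (λ v → [ lookup US u ∧ lookup VS v ∧ not (E u v) ]))

  edges : Subset m → Subset n → ℕ
  edges US VS = ∑ m (λ u → ∑ n (λ v → [ lookup US u ∧ lookup VS v ∧ E u v ]))

  dbarU : Subset n → Fin m → ℕ
  dbarU VX u = ∑ n (λ v → [ lookup VX v ∧ not (E u v) ])

  dbarV : Subset m → Fin n → ℕ
  dbarV UX v = ∑ m (λ u → [ lookup UX u ∧ not (E u v) ])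

  IsDefective : ℕ → Subset m → Subset n → Set
  IsDefective k US VS = nonEdges US VS ≤ k

  record IsInstance (k : ℕ) (US : Subset m) (VS : Subset n)
                    (UC : Subset m) (VC : Subset n) : Set where
    field
      disjointU : Empty (US ∩ UC)
      disjointV : Empty (VS ∩ VC)
      defS      : IsDefective k US VS
      extU      : ∀ u → u Sub.∈ UC → IsDefective k (US ∪ ⁅ u ⁆) VS
      extV      : ∀ v → v Sub.∈ VC → IsDefective k US (VS ∪ ⁅ v ⁆)

  -- G(S ∪ C') with C' = (UC', VC') ⊆ C is a k-MDB derived from (S, C).
  record IsMDB (k : ℕ) (US : Subset m) (VS : Subset n)
               (UC : Subset m) (VC : Subset n)
               (UC' : Subset m) (VC' : Subset n) : Set where
    field
      subU   : UC' ⊆ UC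
      subV   : VC' ⊆ VC
      defD   : IsDefective k (US ∪ UC') (VS ∪ VC')
      maxD   : ∀ (UC'' : Subset m) (VC'' : Subset n) → UC'' ⊆ UC → VC'' ⊆ VC →
               IsDefective k (US ∪ UC'') (VS ∪ VC'') →
               edges (US ∪ UC'') (VS ∪ VC'') ≤ edges (US ∪ UC') (VS ∪ VC')

IsAscEnum : ∀ {p} → (Fin p → ℕ) → Subset p → List (Fin p) → Set
IsAscEnum d X xs = Unique xs × (∀ x → (x L.∈ xs) ⇔ (x Sub.∈ X)) × Linked (λ a b → d a ≤ d b) xs

IsLargestPrefix : ∀ {p} → (Fin p → ℕ) → Subset p → List (Fin p) → ℕ → ℕ → Set
IsLargestPrefix d X xs bound i =
  (i ≤ ∣ X ∣) × (sum (map d (take i xs)) ≤ bound) ×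
  (∀ i' → i' ≤ ∣ X ∣ → sum (map d (take i' xs)) ≤ bound → i' ≤ i)

-- Since S and C′ are
-- disjoint, the non-edges of D include those of S and, for each u ∈ U_C′, the
-- d̄_S(u) non-edges between u and V_S; hence Σ_{u ∈ U_C′} d̄_S(u) ≤ k − |Ē_S|.
-- By an exchange argument any c vertices of U_C have total d̄_S at least the sum
-- of the c smallest values, so c = |U_C′| is an admissible prefix length and
-- |U_C′| ≤ i. The V side is the U side of the transposed graph.
module Submission where

open import Defs
open import Data.Nat using (ℕ; zero; suc; _+_; _≤_; _∸_; z≤n)
open import Data.Bool using (not)
open import Data.Nat.Properties
  using (≤-refl; ≤-trans; +-mono-≤; +-monoʳ-≤; m≤n+m; +-assoc; +-comm; suc-injective;
         m+n≤o⇒m≤o∸n; +-commutativeSemigroup; module ≤-Reasoning)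
open import Data.Fin using (Fin; zero; suc)
open import Data.Fin.Subset
  using (Subset; _∪_; _∩_; _⊆_; _-_; _∈_; ∣_∣; Empty; Nonempty; inside; outside)
open import Data.Fin.Subset.Properties
  using (_∈?_; x∈p∩q⁺; x∈p∩q⁻; drop-∷-Empty; Empty-unique; nonempty?; ∣⊥∣≡0;
         p─⊥≡p; p─q⊆p; p⊆q⇒∣p∣≤∣q∣)
open import Data.Vec using ([]; _∷_; here; there)
open import Data.List using (List; []; _∷_; map; take)
open import Data.Nat.ListAction using (sum)
import Data.List.Membership.Propositional as List
import Data.List.Relation.Unary.Any as Any
import Data.List.Relation.Unary.All as All
import Data.List.Relation.Unary.AllPairs as AllPairs
open import Data.List.Relation.Unary.Linked using (Linked)
import Data.List.Relation.Unary.Linked as Linked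
open import Data.List.Relation.Unary.Linked.Properties using (Linked⇒AllPairs)
open import Data.Product using (_×_; _,_; ∃-syntax)
open import Function using (_∘_)
open import Function.Bundles using (Equivalence)
open import Relation.Binary.PropositionalEquality
  using (_≡_; _≢_; refl; sym; trans; cong; cong₂; subst; module ≡-Reasoning)
open import Relation.Nullary using (yes; no; contradiction)
open import Algebra.Properties.CommutativeSemigroup +-commutativeSemigroup
  using (x∙yz≈y∙xz; interchange)

private
  variable
    m n p q : ℕ

∑-zero : ∀ n → ∑ n (λ _ → 0) ≡ 0
∑-zero zero    = refl
∑-zero (suc n) = ∑-zero n

weight : (Fin p → ℕ) → Subset p → ℕ
weight d []            = 0
weight d (inside  ∷ X) = d zero + weight (d ∘ suc) X
weight d (outside ∷ X) = weight (d ∘ suc) X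

weight-cong : ∀ {d d′ : Fin p → ℕ} → (∀ x → d x ≡ d′ x) → ∀ X → weight d X ≡ weight d′ X
weight-cong eq []            = refl
weight-cong eq (inside  ∷ X) = cong₂ _+_ (eq zero) (weight-cong (eq ∘ suc) X)
weight-cong eq (outside ∷ X) = weight-cong (eq ∘ suc) X

weight-mono-≤ : ∀ {d d′ : Fin p → ℕ} → (∀ x → d x ≤ d′ x) → ∀ X → weight d X ≤ weight d′ X
weight-mono-≤ le []            = z≤n
weight-mono-≤ le (inside  ∷ X) = +-mono-≤ (le zero) (weight-mono-≤ (le ∘ suc) X)
weight-mono-≤ le (outside ∷ X) = weight-mono-≤ (le ∘ suc) X

weight-zero : ∀ (X : Subset p) → weight (λ _ → 0) X ≡ 0
weight-zero []            = refl
weight-zero (inside  ∷ X) = weight-zero X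
weight-zero (outside ∷ X) = weight-zero X

weight-distrib-+ : ∀ (d d′ : Fin p → ℕ) X →
                   weight (λ x → d x + d′ x) X ≡ weight d X + weight d′ X
weight-distrib-+ d d′ []            = refl
weight-distrib-+ d d′ (inside  ∷ X) = begin
  (d zero + d′ zero) + weight (λ x → d (suc x) + d′ (suc x)) X
    ≡⟨ cong ((d zero + d′ zero) +_) (weight-distrib-+ (d ∘ suc) (d′ ∘ suc) X) ⟩
  (d zero + d′ zero) + (weight (d ∘ suc) X + weight (d′ ∘ suc) X)
    ≡⟨ interchange (d zero) (d′ zero) _ _ ⟩
  (d zero + weight (d ∘ suc) X) + (d′ zero + weight (d′ ∘ suc) X) ∎
  where open ≡-Reasoning
weight-distrib-+ d d′ (outside ∷ X) = weight-distrib-+ (d ∘ suc) (d′ ∘ suc) X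

weight-comm : ∀ (f : Fin p → Fin q → ℕ) X Y →
              weight (λ x → weight (f x) Y) X ≡ weight (λ y → weight (λ x → f x y) X) Y
weight-comm f []            Y = sym (weight-zero Y)
weight-comm f (inside  ∷ X) Y = begin
  weight (f zero) Y + weight (λ x → weight (f (suc x)) Y) X
    ≡⟨ cong (weight (f zero) Y +_) (weight-comm (f ∘ suc) X Y) ⟩
  weight (f zero) Y + weight (λ y → weight (λ x → f (suc x) y) X) Y
    ≡⟨ weight-distrib-+ (f zero) _ Y ⟨
  weight (λ y → f zero y + weight (λ x → f (suc x) y) X) Y ∎
  where open ≡-Reasoning
weight-comm f (outside ∷ X) Y = weight-comm (f ∘ suc) X Y

weight-≤-∪ : ∀ (d : Fin p → ℕ) X Y → weight d X ≤ weight d (X ∪ Y)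
weight-≤-∪ d []            []            = z≤n
weight-≤-∪ d (inside  ∷ X) (_       ∷ Y) = +-monoʳ-≤ (d zero) (weight-≤-∪ (d ∘ suc) X Y)
weight-≤-∪ d (outside ∷ X) (inside  ∷ Y) = ≤-trans (weight-≤-∪ (d ∘ suc) X Y) (m≤n+m _ (d zero))
weight-≤-∪ d (outside ∷ X) (outside ∷ Y) = weight-≤-∪ (d ∘ suc) X Y

weight-∪ : ∀ (d : Fin p → ℕ) {X Y} → Empty (X ∩ Y) → weight d (X ∪ Y) ≡ weight d X + weight d Y
weight-∪ d {[]}          {[]}          _ = refl
weight-∪ d {inside  ∷ X} {inside  ∷ Y} disjoint = contradiction (zero , here) disjoint
weight-∪ d {inside  ∷ X} {outside ∷ Y} disjoint = begin
  d zero + weight (d ∘ suc) (X ∪ Y)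
    ≡⟨ cong (d zero +_) (weight-∪ (d ∘ suc) (drop-∷-Empty disjoint)) ⟩
  d zero + (weight (d ∘ suc) X + weight (d ∘ suc) Y)
    ≡⟨ +-assoc (d zero) _ _ ⟨
  (d zero + weight (d ∘ suc) X) + weight (d ∘ suc) Y ∎
  where open ≡-Reasoning
weight-∪ d {outside ∷ X} {inside  ∷ Y} disjoint = begin
  d zero + weight (d ∘ suc) (X ∪ Y)
    ≡⟨ cong (d zero +_) (weight-∪ (d ∘ suc) (drop-∷-Empty disjoint)) ⟩
  d zero + (weight (d ∘ suc) X + weight (d ∘ suc) Y)
    ≡⟨ x∙yz≈y∙xz (d zero) (weight (d ∘ suc) X) (weight (d ∘ suc) Y) ⟩
  weight (d ∘ suc) X + (d zero + weight (d ∘ suc) Y) ∎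
  where open ≡-Reasoning
weight-∪ d {outside ∷ X} {outside ∷ Y} disjoint = weight-∪ (d ∘ suc) (drop-∷-Empty disjoint)

weight-remove : ∀ (d : Fin p → ℕ) {X x} → x ∈ X → weight d X ≡ d x + weight d (X - x)
weight-remove d {inside ∷ X} here = cong (λ Y → d zero + weight (d ∘ suc) Y) (sym (p─⊥≡p X))
weight-remove d {inside ∷ X} {suc x} (there x∈X) = begin
  d zero + weight (d ∘ suc) X
    ≡⟨ cong (d zero +_) (weight-remove (d ∘ suc) x∈X) ⟩
  d zero + (d (suc x) + weight (d ∘ suc) (X - x))
    ≡⟨ x∙yz≈y∙xz (d zero) (d (suc x)) _ ⟩
  d (suc x) + (d zero + weight (d ∘ suc) (X - x)) ∎
  where open ≡-Reasoning
weight-remove d {outside ∷ X} (there x∈X) = weight-remove (d ∘ suc) x∈X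

∣p∣≡weight[1] : ∀ (X : Subset p) → ∣ X ∣ ≡ weight (λ _ → 1) X
∣p∣≡weight[1] []            = refl
∣p∣≡weight[1] (inside  ∷ X) = cong suc (∣p∣≡weight[1] X)
∣p∣≡weight[1] (outside ∷ X) = ∣p∣≡weight[1] X

∣p∪q∣≡∣p∣+∣q∣ : ∀ {X Y : Subset p} → Empty (X ∩ Y) → ∣ X ∪ Y ∣ ≡ ∣ X ∣ + ∣ Y ∣
∣p∪q∣≡∣p∣+∣q∣ {X = X} {Y} disjoint = begin
  ∣ X ∪ Y ∣                                   ≡⟨ ∣p∣≡weight[1] (X ∪ Y) ⟩
  weight (λ _ → 1) (X ∪ Y)                    ≡⟨ weight-∪ (λ _ → 1) disjoint ⟩
  weight (λ _ → 1) X + weight (λ _ → 1) Y     ≡⟨ cong₂ _+_ (∣p∣≡weight[1] X) (∣p∣≡weight[1] Y) ⟨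
  ∣ X ∣ + ∣ Y ∣                               ∎
  where open ≡-Reasoning

x∈p⇒∣p∣≡1+∣p-x∣ : ∀ {X : Subset p} {x} → x ∈ X → ∣ X ∣ ≡ suc ∣ X - x ∣
x∈p⇒∣p∣≡1+∣p-x∣ {X = X} {x} x∈X = begin
  ∣ X ∣                               ≡⟨ ∣p∣≡weight[1] X ⟩
  weight (λ _ → 1) X                  ≡⟨ weight-remove (λ _ → 1) x∈X ⟩
  suc (weight (λ _ → 1) (X - x))      ≡⟨ cong suc (∣p∣≡weight[1] (X - x)) ⟨
  suc ∣ X - x ∣                       ∎
  where open ≡-Reasoning

x∈p-y⇒x≢y : ∀ {X : Subset p} {x} y → x ∈ X - y → x ≢ y
x∈p-y⇒x≢y {X = _ ∷ _} zero    (there _)   ()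
x∈p-y⇒x≢y {X = _ ∷ _} (suc y) here        ()
x∈p-y⇒x≢y {X = _ ∷ _} (suc y) (there x∈X) refl = x∈p-y⇒x≢y y x∈X refl

∣p∣≡1+c⇒Nonempty : ∀ {X : Subset p} {c} → ∣ X ∣ ≡ suc c → Nonempty X
∣p∣≡1+c⇒Nonempty {p} {X} ∣X∣≡1+c with nonempty? X
... | yes nonempty = nonempty
... | no  empty    with () ← trans (sym ∣X∣≡1+c) (trans (cong ∣_∣ (Empty-unique empty)) (∣⊥∣≡0 p))

Empty-∩-⊆ : ∀ {X Y Z : Subset p} → Empty (X ∩ Y) → Z ⊆ Y → Empty (X ∩ Z)
Empty-∩-⊆ disjoint Z⊆Y (x , x∈X∩Z) with x∈X , x∈Z ← x∈p∩q⁻ _ _ x∈X∩Z =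
  disjoint (x , x∈p∩q⁺ (x∈X , Z⊆Y x∈Z))

module _ (d : Fin p → ℕ) where

  private
    Ascending : List (Fin p) → Set
    Ascending = Linked (λ a b → d a ≤ d b)

  exchange : ∀ {x xs} {X : Subset p} → Ascending (x ∷ xs) →
             (∀ {y} → y ∈ X → y List.∈ x ∷ xs) → Nonempty X →
             ∃[ y ] y ∈ X × d x ≤ d y × (∀ {z} → z ∈ X - y → z List.∈ xs)
  exchange {x} {xs} {X} ascending X⊆x∷xs (y , y∈X) with x ∈? X
  ... | yes x∈X = x , x∈X , ≤-refl , λ z∈X-x →
    Any.tail (x∈p-y⇒x≢y x z∈X-x) (X⊆x∷xs (p─q⊆p _ _ z∈X-x))
  ... | no  x∉X = y , y∈X , All.lookup (AllPairs.head (Linked⇒AllPairs ≤-trans ascending)) (drop y∈X)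
                , λ z∈X-y → drop (p─q⊆p _ _ z∈X-y)
    where
    drop : ∀ {z} → z ∈ X → z List.∈ xs
    drop {z} z∈X = Any.tail (λ { refl → x∉X z∈X }) (X⊆x∷xs z∈X)

  sum-take-≤-weight : ∀ {xs} → Ascending xs → (X : Subset p) → (∀ {y} → y ∈ X → y List.∈ xs) →
                      ∀ c → ∣ X ∣ ≡ c → sum (map d (take c xs)) ≤ weight d X
  sum-take-≤-weight {xs}     _         _ _    zero    _        = z≤n
  sum-take-≤-weight {[]}     _         _ _    (suc c) _        = z≤n
  sum-take-≤-weight {x ∷ xs} ascending X X⊆xs (suc c) ∣X∣≡1+c
    with y , y∈X , dx≤dy , X-y⊆xs ← exchange ascending X⊆xs (∣p∣≡1+c⇒Nonempty ∣X∣≡1+c) = begin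
      d x + sum (map d (take c xs))
        ≤⟨ +-mono-≤ dx≤dy (sum-take-≤-weight (Linked.tail ascending) (X - y) X-y⊆xs c ∣X-y∣≡c) ⟩
      d y + weight d (X - y)  ≡⟨ weight-remove d y∈X ⟨
      weight d X              ∎
    where
    open ≤-Reasoning
    ∣X-y∣≡c : ∣ X - y ∣ ≡ c
    ∣X-y∣≡c = suc-injective (trans (sym (x∈p⇒∣p∣≡1+∣p-x∣ y∈X)) ∣X∣≡1+c)

  largestPrefix-bound : ∀ {X Y : Subset p} {xs b i} → IsAscEnum d X xs → IsLargestPrefix d X xs b i →
                        Y ⊆ X → weight d Y ≤ b → ∣ Y ∣ ≤ i
  largestPrefix-bound {Y = Y} (_ , enumerates , ascending) (_ , _ , largest) Y⊆X weight≤b =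
    largest ∣ Y ∣ (p⊆q⇒∣p∣≤∣q∣ Y⊆X)
      (≤-trans (sum-take-≤-weight ascending Y (λ y∈Y → Equivalence.from (enumerates _) (Y⊆X y∈Y)) ∣ Y ∣ refl)
               weight≤b)

nonEdges≡weight : ∀ (E : BGraph m n) A B → nonEdges E A B ≡ weight (dbarU E B) A
nonEdges≡weight E []            B = refl
nonEdges≡weight E (inside  ∷ A) B = cong (dbarU E B zero +_) (nonEdges≡weight (E ∘ suc) A B)
nonEdges≡weight {n = n} E (outside ∷ A) B =
  cong₂ _+_ (∑-zero n) (nonEdges≡weight (E ∘ suc) A B)

dbarU≡weight : ∀ (E : BGraph m n) B u → dbarU E B u ≡ weight (λ v → [ not (E u v) ]) B
dbarU≡weight E []            u = refl
dbarU≡weight E (inside  ∷ B) u = cong ([ not (E u zero) ] +_) (dbarU≡weight (λ u → E u ∘ suc) B u)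
dbarU≡weight E (outside ∷ B) u = dbarU≡weight (λ u → E u ∘ suc) B u

dbarU-≤-∪ : ∀ (E : BGraph m n) B B′ u → dbarU E B u ≤ dbarU E (B ∪ B′) u
dbarU-≤-∪ E B B′ u = begin
  dbarU E B u                                ≡⟨ dbarU≡weight E B u ⟩
  weight (λ v → [ not (E u v) ]) B           ≤⟨ weight-≤-∪ _ B B′ ⟩
  weight (λ v → [ not (E u v) ]) (B ∪ B′)    ≡⟨ dbarU≡weight E (B ∪ B′) u ⟨
  dbarU E (B ∪ B′) u                         ∎
  where open ≤-Reasoning

transpose : BGraph m n → BGraph n m
transpose E v u = E u v

nonEdges-transpose : ∀ (E : BGraph m n) A B → nonEdges E A B ≡ nonEdges (transpose E) B A
nonEdges-transpose E A B = begin
  nonEdges E A B                                            ≡⟨ nonEdges≡weight² E A B ⟩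
  weight (λ u → weight (λ v → [ not (E u v) ]) B) A         ≡⟨ weight-comm _ A B ⟩
  weight (λ v → weight (λ u → [ not (E u v) ]) A) B         ≡⟨ nonEdges≡weight² (transpose E) B A ⟨
  nonEdges (transpose E) B A                                ∎
  where
  open ≡-Reasoning
  nonEdges≡weight² : ∀ {m n} (E : BGraph m n) A B →
                     nonEdges E A B ≡ weight (λ u → weight (λ v → [ not (E u v) ]) B) A
  nonEdges≡weight² E A B = trans (nonEdges≡weight E A B) (weight-cong (dbarU≡weight E B) A)

nonEdges-∪-≥ : ∀ (E : BGraph m n) {A A′} B B′ → Empty (A ∩ A′) →
               weight (dbarU E B) A′ + nonEdges E A B ≤ nonEdges E (A ∪ A′) (B ∪ B′)
nonEdges-∪-≥ E {A} {A′} B B′ disjoint = begin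
  weight (dbarU E B) A′ + nonEdges E A B          ≡⟨ cong (weight (dbarU E B) A′ +_) (nonEdges≡weight E A B) ⟩
  weight (dbarU E B) A′ + weight (dbarU E B) A    ≡⟨ +-comm (weight (dbarU E B) A′) _ ⟩
  weight (dbarU E B) A + weight (dbarU E B) A′    ≡⟨ weight-∪ (dbarU E B) disjoint ⟨
  weight (dbarU E B) (A ∪ A′)                     ≤⟨ weight-mono-≤ (dbarU-≤-∪ E B B′) (A ∪ A′) ⟩
  weight (dbarU E (B ∪ B′)) (A ∪ A′)              ≡⟨ nonEdges≡weight E (A ∪ A′) (B ∪ B′) ⟨
  nonEdges E (A ∪ A′) (B ∪ B′)                    ∎
  where open ≤-Reasoning

∣US∪UC′∣≤∣US∣+i : ∀ (E : BGraph m n) {k US UC UC′ VS VC′ us i} →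
                  Empty (US ∩ UC) → IsAscEnum (dbarU E VS) UC us →
                  IsLargestPrefix (dbarU E VS) UC us (k ∸ nonEdges E US VS) i →
                  UC′ ⊆ UC → IsDefective E k (US ∪ UC′) (VS ∪ VC′) →
                  ∣ US ∪ UC′ ∣ ≤ ∣ US ∣ + i
∣US∪UC′∣≤∣US∣+i E {k} {US} {UC} {UC′} {VS} {VC′} disjoint enumeration largest UC′⊆UC defective = begin
  ∣ US ∪ UC′ ∣     ≡⟨ ∣p∪q∣≡∣p∣+∣q∣ disjoint′ ⟩
  ∣ US ∣ + ∣ UC′ ∣ ≤⟨ +-monoʳ-≤ ∣ US ∣ (largestPrefix-bound (dbarU E VS) enumeration largest UC′⊆UC budget) ⟩
  ∣ US ∣ + _       ∎
  where
  open ≤-Reasoning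
  disjoint′ : Empty (US ∩ UC′)
  disjoint′ = Empty-∩-⊆ disjoint UC′⊆UC
  budget : weight (dbarU E VS) UC′ ≤ k ∸ nonEdges E US VS
  budget = m+n≤o⇒m≤o∸n _ (≤-trans (nonEdges-∪-≥ E VS VC′ disjoint′) defective)

mainTheorem10 : ∀ {m n : ℕ} (E : BGraph m n) (k : ℕ)
    (US UC : Subset m) (VS VC : Subset n) →
    IsInstance E k US VS UC VC →
    (us : List (Fin m)) → IsAscEnum (dbarU E VS) UC us →
    (vs : List (Fin n)) → IsAscEnum (dbarV E US) VC vs →
    (i j : ℕ) →
    IsLargestPrefix (dbarU E VS) UC us (k ∸ nonEdges E US VS) i →
    IsLargestPrefix (dbarV E US) VC vs (k ∸ nonEdges E US VS) j →
    (UC' : Subset m) (VC' : Subset n) → IsMDB E k US VS UC VC UC' VC' →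
    (∣ US ∪ UC' ∣ ≤ ∣ US ∣ + i) × (∣ VS ∪ VC' ∣ ≤ ∣ VS ∣ + j)
mainTheorem10 E k US UC VS VC instance′ us usAsc vs vsAsc i j largestU largestV UC' VC' mdb =
    ∣US∪UC′∣≤∣US∣+i E {VS = VS} {VC′ = VC'} disjointU usAsc largestU subU defD
  , ∣US∪UC′∣≤∣US∣+i (transpose E) {VS = US} {VC′ = UC'} disjointV vsAsc largestVᵀ subV defDᵀ
  where
  -- vsAsc is accepted as is: dbarV E US is definitionally dbarU (transpose E) US.
  open IsInstance instance′ using (disjointU; disjointV)
  open IsMDB mdb using (subU; subV; defD)
  largestVᵀ : IsLargestPrefix (dbarV E US) VC vs (k ∸ nonEdges (transpose E) VS US) j
  largestVᵀ = subst (λ e → IsLargestPrefix (dbarV E US) VC vs (k ∸ e) j) (nonEdges-transpose E US VS) largestV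
  defDᵀ : IsDefective (transpose E) k (VS ∪ VC') (US ∪ UC')
  defDᵀ = subst (_≤ k) (nonEdges-transpose E (US ∪ UC') (VS ∪ VC')) defD
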